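{- Let $m\ge1$, $v=2^m$, and let $S_v$ be the Sylvester Hadamard matrix indexed by $\mathbb{F}_2^m$ with $(S_v)_{x,y}=(-1)^{\langle x,y\rangle}$, $\langle x,y\rangle=\sum_{i=1}^mx_iy_i$. For an invertible $m\times m$ matrix $A$ over $\mathbb{F}_2$, $b,d\in\mathbb{F}_2^m$ and $c\in\{1,-1\}$, let $T_{A,b,d,c}$ be the linear map on functions $f:\mathbb{F}_2^m\to\mathbb{R}$ given by $(T_{A,b,d,c}f)(x)=f(A^{ -1}x+A^{ -1}b)(-1)^{\langle d,x\rangle}c$, viewed as a $v\times v$ signed permutation matrix. Then $T_{A,b,d,c}$ commutes with $S_v$ (i.e. $T_{A,b,d,c}\in\mathrm{SAut}(S_v)$) if and only if $A^t=A^{ -1}$, $b=d$, and the Hamming weight of $b$ is even.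
   Context: $S_v$ acts on functions by $(S_vf)(y)=\sum_x f(x)(-1)^{\langle x,y\rangle}$. For a Hadamard matrix $H$ of order $v$, $\mathrm{SAut}(H)$ is the set of $v\times v$ signed permutation matrices $P$ (products of a permutation matrix and a diagonal $\pm1$ matrix) such that $PH=HP$. -}

module Defs where

open import Data.Bool using (Bool; true; false; _∧_; _xor_; if_then_else_)
open import Data.Nat using (ℕ; zero; suc)
open import Data.Integer using (ℤ; +_; -_; _*_; _+_)
open import Data.List using (List; []; _∷_; _++_; map; foldr)
open import Data.Vec using (Vec; []; _∷_; zipWith; transpose; tabulate; count)
  renaming (map to vmap; foldr′ to vfoldr)
open import Data.Vec.Properties using (≡-dec)
open import Data.Bool.Properties using () renaming (_≟_ to _≟B_)
open import Data.Fin using (Fin; _≟_)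
open import Relation.Nullary using (yes; no; does)
open import Relation.Binary.PropositionalEquality using (_≡_)

-- Vectors of F₂^m: Bool = F₂ (false = 0, true = 1), addition = xor.
F2V : ℕ → Set
F2V m = Vec Bool m

-- m×m matrices over F₂, as a vector of rows.
F2Mat : ℕ → Set
F2Mat m = Vec (Vec Bool m) m

allVecs : (m : ℕ) → List (F2V m)
allVecs zero = [] ∷ []
allVecs (suc m) = map (false ∷_) (allVecs m) ++ map (true ∷_) (allVecs m)

dot : ∀ {m} → F2V m → F2V m → Bool
dot x y = vfoldr _xor_ false (zipWith _∧_ x y)

_+v_ : ∀ {m} → F2V m → F2V m → F2V m
x +v y = zipWith _xor_ x y

matVec : ∀ {m} → F2Mat m → F2V m → F2V m
matVec A x = vmap (λ row → dot row x) A

matMul : ∀ {m} → F2Mat m → F2Mat m → F2Mat m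
matMul A B = vmap (λ row → vmap (λ col → dot row col) (transpose B)) A

idMat : (m : ℕ) → F2Mat m
idMat m = tabulate (λ i → tabulate (λ j → does (i ≟ j)))

weight : ∀ {m} → F2V m → ℕ
weight x = count (λ b → b ≟B true) x

sgn : Bool → ℤ
sgn false = + 1
sgn true = - (+ 1)

Syl : ∀ {m} → F2V m → F2V m → ℤ
Syl x y = sgn (dot x y)

-- The matrix of T_{A,b,d,c} (given A⁻¹ = Ainv):
-- (T f)(x) = f(A⁻¹x + A⁻¹b) (-1)^⟨d,x⟩ c, so
-- T_{x,y} = (-1)^⟨d,x⟩ c if y = A⁻¹x + A⁻¹b, and 0 otherwise.
Tmat : ∀ {m} → F2Mat m → F2V m → F2V m → ℤ → F2V m → F2V m → ℤ
Tmat Ainv b d c x y with ≡-dec _≟B_ y (matVec Ainv x +v matVec Ainv b)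
... | yes _ = sgn (dot d x) * c
... | no _ = + 0

prodEntry : ∀ m → (F2V m → F2V m → ℤ) → (F2V m → F2V m → ℤ) → F2V m → F2V m → ℤ
prodEntry m M N x z = foldr _+_ (+ 0) (map (λ y → M x y * N y z) (allVecs m))

Commute : ∀ m → (F2V m → F2V m → ℤ) → (F2V m → F2V m → ℤ) → Set
Commute m M N = ∀ x z → prodEntry m M N x z ≡ prodEntry m N M x z

module Submission where

-- Row x of T has its only nonzero entry, (-1)^⟨d,x⟩ c, in column A⁻¹x + A⁻¹b; equivalently
-- column z has it in row Az + b.  Hence (TS)_{x,z} = (-1)^(⟨d,x⟩ + ⟨A⁻¹x + A⁻¹b, z⟩) c and
-- (ST)_{x,z} = (-1)^(⟨x, Az + b⟩ + ⟨d, Az + b⟩) c, and T commutes with S exactly when these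
-- exponents agree over F₂ for all x, z.  Putting z = 0 and then x = 0 gives ⟨d,b⟩ = 0 and
-- ⟨d,x⟩ = ⟨b,x⟩ for all x, so d = b and ⟨b,b⟩ = wt(b) mod 2 vanishes; what remains is
-- ⟨A⁻¹x, z⟩ = ⟨x, Az⟩ = ⟨Aᵗx, z⟩, i.e. A⁻¹ = Aᵗ.  The converse is the same computation.

open import Defs
open import Level using (0ℓ)
open import Data.Bool using (Bool; true; false; _∧_; _xor_; not)
open import Data.Bool.Properties
  using (xor-∧-commutativeRing; xor-comm; xor-same; xor-assoc; xor-identityʳ; ∧-comm; ∧-zeroʳ; ∧-identityʳ;
         not-involutive; not-injective)
  renaming (_≟_ to _≟B_)
open import Data.Empty using (⊥-elim)
open import Data.Fin using (Fin) renaming (_≟_ to _≟F_)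
open import Data.Integer using (ℤ; +_; -_; _+_; _*_; NonZero)
open import Data.Integer.Properties
  using (+-identityʳ; +-identityˡ; +-assoc; *-assoc; *-zeroʳ; *-cancelʳ-≡; *-commutativeSemigroup)
open import Algebra.Properties.CommutativeSemigroup *-commutativeSemigroup using (xy∙z≈xz∙y)
open import Data.List using (List; []; _∷_; _++_; map; foldr)
open import Data.List.Properties using (map-++; map-∘)
open import Data.Maybe using (nothing)
open import Data.Nat using (ℕ; zero; suc; _≤_)
open import Data.Nat.Divisibility using (_∣_; divides)
open import Data.Nat.Properties using (suc-injective)
open import Data.Product using (_×_; _,_)
open import Data.Product.Function.NonDependent.Propositional using (_×-⇔_)
open import Data.Sum using (_⊎_; inj₁; inj₂)
open import Data.Vec using (Vec; []; _∷_; head; tail; replicate; _⊛_; tabulate; lookup; transpose)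
  renaming (map to vmap)
open import Data.Vec.Properties
  using (zipWith-assoc; zipWith-identityˡ; zipWith-identityʳ; map-cong; tabulate-cong; tabulate-∘;
         tabulate∘lookup; ≡-dec)
open import Function.Bundles using (_⇔_; mk⇔)
open import Function.Construct.Composition using (_⇔-∘_)
open import Function.Construct.Identity using (⇔-id)
open import Relation.Nullary using (yes; no; does)
open import Relation.Binary.PropositionalEquality
  using (_≡_; _≢_; refl; sym; trans; cong; cong₂; subst; module ≡-Reasoning)
open import Tactic.RingSolver using (solve-∀)
open import Tactic.RingSolver.Core.AlmostCommutativeRing using (AlmostCommutativeRing; fromCommutativeRing)

𝔽₂ : AlmostCommutativeRing 0ℓ 0ℓ
𝔽₂ = fromCommutativeRing xor-∧-commutativeRing (λ _ → nothing)

xor-cancelˡ : ∀ p {q r} → p xor q ≡ p xor r → q ≡ r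
xor-cancelˡ false e = e
xor-cancelˡ true  e = not-injective e

xor-cancelʳ : ∀ r {q s} → q xor r ≡ s xor r → q ≡ s
xor-cancelʳ r {q} {s} e = xor-cancelˡ r (trans (xor-comm r q) (trans e (xor-comm s r)))

zeros : ∀ n → F2V n
zeros n = replicate n false

+v-identityˡ : ∀ {n} (x : F2V n) → zeros n +v x ≡ x
+v-identityˡ = zipWith-identityˡ (λ _ → refl)

+v-identityʳ : ∀ {n} (x : F2V n) → x +v zeros n ≡ x
+v-identityʳ = zipWith-identityʳ xor-identityʳ

+v-assoc : ∀ {n} (x y z : F2V n) → (x +v y) +v z ≡ x +v (y +v z)
+v-assoc = zipWith-assoc xor-assoc

+v-self : ∀ {n} (x : F2V n) → x +v x ≡ zeros n
+v-self []      = refl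
+v-self (a ∷ x) = cong₂ _∷_ (xor-same a) (+v-self x)

dot-comm : ∀ {n} (x y : F2V n) → dot x y ≡ dot y x
dot-comm []      []      = refl
dot-comm (a ∷ x) (b ∷ y) = cong₂ _xor_ (∧-comm a b) (dot-comm x y)

dot-distribʳ-+v : ∀ {n} (x y z : F2V n) → dot (x +v y) z ≡ dot x z xor dot y z
dot-distribʳ-+v []      []      []      = refl
dot-distribʳ-+v (a ∷ x) (b ∷ y) (c ∷ z) =
  trans (cong (((a xor b) ∧ c) xor_) (dot-distribʳ-+v x y z)) (interchange a b c (dot x z) (dot y z))
  where
  interchange : ∀ a b c p q → ((a xor b) ∧ c) xor (p xor q) ≡ ((a ∧ c) xor p) xor ((b ∧ c) xor q)
  interchange = solve-∀ 𝔽₂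

dot-distribˡ-+v : ∀ {n} (z x y : F2V n) → dot z (x +v y) ≡ dot z x xor dot z y
dot-distribˡ-+v z x y = begin
  dot z (x +v y)          ≡⟨ dot-comm z (x +v y) ⟩
  dot (x +v y) z          ≡⟨ dot-distribʳ-+v x y z ⟩
  dot x z xor dot y z     ≡⟨ cong₂ _xor_ (dot-comm x z) (dot-comm y z) ⟩
  dot z x xor dot z y     ∎
  where open ≡-Reasoning

dot-zeroʳ : ∀ {n} (x : F2V n) → dot x (zeros n) ≡ false
dot-zeroʳ []      = refl
dot-zeroʳ (a ∷ x) = cong₂ _xor_ (∧-zeroʳ a) (dot-zeroʳ x)

dot-zeroˡ : ∀ {n} (x : F2V n) → dot (zeros n) x ≡ false
dot-zeroˡ x = trans (dot-comm _ x) (dot-zeroʳ x)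

dot-extensional : ∀ {n} (u v : F2V n) → (∀ z → dot u z ≡ dot v z) → u ≡ v
dot-extensional []      []      _ = refl
dot-extensional (a ∷ u) (b ∷ v) h = cong₂ _∷_ heads (dot-extensional u v tails)
  where
  dot-unit : ∀ {n} c (w : F2V n) → dot (c ∷ w) (true ∷ zeros n) ≡ c
  dot-unit c w = trans (cong₂ _xor_ (∧-identityʳ c) (dot-zeroʳ w)) (xor-identityʳ c)
  heads : a ≡ b
  heads = trans (sym (dot-unit a u)) (trans (h (true ∷ zeros _)) (dot-unit b v))
  tails : ∀ z → dot u z ≡ dot v z
  tails z = trans (cong (_xor dot u z) (sym (∧-zeroʳ a)))
                  (trans (h (false ∷ z)) (cong (_xor dot v z) (∧-zeroʳ b)))

-- `matVec` for rectangular matrices; on square ones the two agree definitionally.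
mulVec : ∀ {k n} → Vec (F2V n) k → F2V n → F2V k
mulVec M x = vmap (λ row → dot row x) M

mulVec-+v : ∀ {k n} (M : Vec (F2V n) k) x y → mulVec M (x +v y) ≡ mulVec M x +v mulVec M y
mulVec-+v []      x y = refl
mulVec-+v (r ∷ M) x y = cong₂ _∷_ (dot-distribˡ-+v r x y) (mulVec-+v M x y)

mulVec-zeros : ∀ {k n} (M : Vec (F2V n) k) → mulVec M (zeros n) ≡ zeros k
mulVec-zeros []      = refl
mulVec-zeros (r ∷ M) = cong₂ _∷_ (dot-zeroʳ r) (mulVec-zeros M)

mulVec-extensional : ∀ {k n} (M N : Vec (F2V n) k) → (∀ x → mulVec M x ≡ mulVec N x) → M ≡ N
mulVec-extensional []      []      _ = refl
mulVec-extensional (r ∷ M) (s ∷ N) h =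
  cong₂ _∷_ (dot-extensional r s (λ x → cong head (h x)))
            (mulVec-extensional M N (λ x → cong tail (h x)))

-- `(replicate n _∷_ ⊛ r) ⊛ T` is T with r prepended as first column; `transpose (r ∷ A)` unfolds to it.
dot-mulVec-prependColumn : ∀ {k n} (r : F2V n) (T : Vec (F2V k) n) u₀ u z →
  dot (mulVec ((replicate n _∷_ ⊛ r) ⊛ T) (u₀ ∷ u)) z ≡ (u₀ ∧ dot r z) xor dot (mulVec T u) z
dot-mulVec-prependColumn []      []      u₀ u []      = cong (_xor false) (sym (∧-zeroʳ u₀))
dot-mulVec-prependColumn (a ∷ r) (t ∷ T) u₀ u (z₀ ∷ z) =
  trans (cong ((((a ∧ u₀) xor dot t u) ∧ z₀) xor_) (dot-mulVec-prependColumn r T u₀ u z))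
        (regroup a u₀ (dot t u) z₀ (dot r z) (dot (mulVec T u) z))
  where
  regroup : ∀ a u₀ s z₀ p q → (((a ∧ u₀) xor s) ∧ z₀) xor ((u₀ ∧ p) xor q)
                             ≡ (u₀ ∧ ((a ∧ z₀) xor p)) xor ((s ∧ z₀) xor q)
  regroup = solve-∀ 𝔽₂

dot-mulVec-transpose : ∀ {k n} (A : Vec (F2V n) k) u z →
  dot (mulVec (transpose A) u) z ≡ dot u (mulVec A z)
dot-mulVec-transpose []      []       z = nil z
  where
  nil : ∀ {n} (z : F2V n) → dot (mulVec (replicate n []) []) z ≡ false
  nil []      = refl
  nil (_ ∷ z) = nil z
dot-mulVec-transpose (r ∷ A) (u₀ ∷ u) z =
  trans (dot-mulVec-prependColumn r (transpose A) u₀ u z)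
        (cong ((u₀ ∧ dot r z) xor_) (dot-mulVec-transpose A u z))

matVec-matMul : ∀ {m} (A B : F2Mat m) x → matVec (matMul A B) x ≡ matVec A (matVec B x)
matVec-matMul {m} A B x = rows A
  where
  rows : ∀ {k} (A : Vec (F2V m) k) →
         mulVec (vmap (λ row → vmap (λ col → dot row col) (transpose B)) A) x ≡ mulVec A (mulVec B x)
  rows []      = refl
  rows (r ∷ A) = cong₂ _∷_
    (trans (cong (λ v → dot v x) (map-cong (dot-comm r) (transpose B)))
           (dot-mulVec-transpose B r x))
    (rows A)

matVec-idMat : ∀ {m} (x : F2V m) → matVec (idMat m) x ≡ x
matVec-idMat {m} x =
  trans (sym (tabulate-∘ (λ row → dot row x) (λ i → tabulate (λ j → does (i ≟F j)))))
        (trans (tabulate-cong (λ i → dot-unit i x)) (tabulate∘lookup x))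
  where
  dot-unit : ∀ {n} (i : Fin n) (x : F2V n) → dot (tabulate (λ j → does (i ≟F j))) x ≡ lookup x i
  dot-unit Fin.zero    (a ∷ x) = trans (cong (a xor_) (dot-falses x)) (xor-identityʳ a)
    where
    dot-falses : ∀ {n} (x : F2V n) → dot (tabulate (λ _ → false)) x ≡ false
    dot-falses []      = refl
    dot-falses (_ ∷ x) = dot-falses x
  dot-unit (Fin.suc i) (a ∷ x) = dot-unit i x

module _ {m} (A Ai : F2Mat m) (b : F2V m) where
  open ≡-Reasoning

  affine-leftInverse : matMul Ai A ≡ idMat m → ∀ z → matVec Ai (matVec A z +v b) +v matVec Ai b ≡ z
  affine-leftInverse AiA z = begin
    matVec Ai (matVec A z +v b) +v matVec Ai b                ≡⟨ cong (_+v matVec Ai b) (mulVec-+v Ai (matVec A z) b) ⟩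
    (matVec Ai (matVec A z) +v matVec Ai b) +v matVec Ai b    ≡⟨ +v-assoc _ _ _ ⟩
    matVec Ai (matVec A z) +v (matVec Ai b +v matVec Ai b)    ≡⟨ cong₂ _+v_ (sym (matVec-matMul Ai A z)) (+v-self _) ⟩
    matVec (matMul Ai A) z +v zeros m                         ≡⟨ +v-identityʳ _ ⟩
    matVec (matMul Ai A) z                                    ≡⟨ cong (λ M → matVec M z) AiA ⟩
    matVec (idMat m) z                                        ≡⟨ matVec-idMat z ⟩
    z                                                         ∎

  affine-rightInverse : matMul A Ai ≡ idMat m → ∀ y → matVec A (matVec Ai y +v matVec Ai b) +v b ≡ y
  affine-rightInverse AAi y = begin
    matVec A (matVec Ai y +v matVec Ai b) +v b    ≡⟨ cong (λ v → matVec A v +v b) (sym (mulVec-+v Ai y b)) ⟩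
    matVec A (matVec Ai (y +v b)) +v b            ≡⟨ cong (_+v b) (sym (matVec-matMul A Ai (y +v b))) ⟩
    matVec (matMul A Ai) (y +v b) +v b            ≡⟨ cong (λ M → matVec M (y +v b) +v b) AAi ⟩
    matVec (idMat m) (y +v b) +v b                ≡⟨ cong (_+v b) (matVec-idMat (y +v b)) ⟩
    (y +v b) +v b                                 ≡⟨ +v-assoc y b b ⟩
    y +v (b +v b)                                 ≡⟨ cong (y +v_) (+v-self b) ⟩
    y +v zeros m                                  ≡⟨ +v-identityʳ y ⟩
    y                                             ∎

odd : ℕ → Bool
odd zero    = false
odd (suc n) = not (odd n)

dot-self : ∀ {n} (x : F2V n) → dot x x ≡ odd (weight x)
dot-self []          = refl
dot-self (true ∷ x)  = cong not (dot-self x)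
dot-self (false ∷ x) = dot-self x

even⇒2∣ : ∀ n → odd n ≡ false → 2 ∣ n
even⇒2∣ zero          _ = divides 0 refl
even⇒2∣ (suc zero)    ()
even⇒2∣ (suc (suc n)) e with even⇒2∣ n (trans (sym (not-involutive (odd n))) e)
... | divides q eq = divides (suc q) (cong (λ k → suc (suc k)) eq)

2∣⇒even : ∀ n → 2 ∣ n → odd n ≡ false
2∣⇒even zero          _                  = refl
2∣⇒even (suc zero)    (divides zero ())
2∣⇒even (suc zero)    (divides (suc _) ())
2∣⇒even (suc (suc n)) (divides zero ())
2∣⇒even (suc (suc n)) (divides (suc q) eq) =
  trans (not-involutive (odd n)) (2∣⇒even n (divides q (suc-injective (suc-injective eq))))

sumList : List ℤ → ℤ
sumList = foldr _+_ (+ 0)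

sumList-++ : ∀ xs ys → sumList (xs ++ ys) ≡ sumList xs + sumList ys
sumList-++ []       ys = sym (+-identityˡ _)
sumList-++ (x ∷ xs) ys = trans (cong (_+_ x) (sumList-++ xs ys)) (sym (+-assoc x (sumList xs) (sumList ys)))

sumVecs : ∀ m → (F2V m → ℤ) → ℤ
sumVecs m h = sumList (map h (allVecs m))

sumVecs-suc : ∀ m (h : F2V (suc m) → ℤ) →
  sumVecs (suc m) h ≡ sumVecs m (λ y → h (false ∷ y)) + sumVecs m (λ y → h (true ∷ y))
sumVecs-suc m h = begin
  sumList (map h (map (false ∷_) vs ++ map (true ∷_) vs))
    ≡⟨ cong sumList (map-++ h (map (false ∷_) vs) (map (true ∷_) vs)) ⟩
  sumList (map h (map (false ∷_) vs) ++ map h (map (true ∷_) vs))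
    ≡⟨ sumList-++ (map h (map (false ∷_) vs)) (map h (map (true ∷_) vs)) ⟩
  sumList (map h (map (false ∷_) vs)) + sumList (map h (map (true ∷_) vs))
    ≡⟨ cong₂ _+_ (cong sumList (sym (map-∘ vs))) (cong sumList (sym (map-∘ vs))) ⟩
  sumVecs m (λ y → h (false ∷ y)) + sumVecs m (λ y → h (true ∷ y)) ∎
  where
  open ≡-Reasoning
  vs : List (F2V m)
  vs = allVecs m

sumVecs-zero : ∀ m (h : F2V m → ℤ) → (∀ y → h y ≡ + 0) → sumVecs m h ≡ + 0
sumVecs-zero zero    h h≡0 = trans (+-identityʳ _) (h≡0 [])
sumVecs-zero (suc m) h h≡0 = trans (sumVecs-suc m h)
  (cong₂ _+_ (sumVecs-zero m _ (λ y → h≡0 (false ∷ y))) (sumVecs-zero m _ (λ y → h≡0 (true ∷ y))))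

sumVecs-delta : ∀ m (h : F2V m → ℤ) w → (∀ y → y ≢ w → h y ≡ + 0) → sumVecs m h ≡ h w
sumVecs-delta zero    h []          _   = +-identityʳ _
sumVecs-delta (suc m) h (false ∷ w) off = begin
  sumVecs (suc m) h                                                 ≡⟨ sumVecs-suc m h ⟩
  sumVecs m (λ y → h (false ∷ y)) + sumVecs m (λ y → h (true ∷ y))   ≡⟨ cong₂ _+_ hit miss ⟩
  h (false ∷ w) + + 0                                               ≡⟨ +-identityʳ _ ⟩
  h (false ∷ w)                                                     ∎
  where
  open ≡-Reasoning
  hit : sumVecs m (λ y → h (false ∷ y)) ≡ h (false ∷ w)
  hit = sumVecs-delta m _ w (λ y y≢w → off (false ∷ y) (λ { refl → y≢w refl }))
  miss : sumVecs m (λ y → h (true ∷ y)) ≡ + 0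
  miss = sumVecs-zero m _ (λ y → off (true ∷ y) (λ ()))
sumVecs-delta (suc m) h (true ∷ w) off = begin
  sumVecs (suc m) h                                                 ≡⟨ sumVecs-suc m h ⟩
  sumVecs m (λ y → h (false ∷ y)) + sumVecs m (λ y → h (true ∷ y))   ≡⟨ cong₂ _+_ miss hit ⟩
  + 0 + h (true ∷ w)                                                ≡⟨ +-identityˡ _ ⟩
  h (true ∷ w)                                                      ∎
  where
  open ≡-Reasoning
  hit : sumVecs m (λ y → h (true ∷ y)) ≡ h (true ∷ w)
  hit = sumVecs-delta m _ w (λ y y≢w → off (true ∷ y) (λ { refl → y≢w refl }))
  miss : sumVecs m (λ y → h (false ∷ y)) ≡ + 0
  miss = sumVecs-zero m _ (λ y → off (false ∷ y) (λ ()))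

sgn-xor : ∀ p q → sgn (p xor q) ≡ sgn p * sgn q
sgn-xor false false = refl
sgn-xor false true  = refl
sgn-xor true  false = refl
sgn-xor true  true  = refl

sgn-injective : ∀ {p q} → sgn p ≡ sgn q → p ≡ q
sgn-injective {false} {false} _ = refl
sgn-injective {false} {true}  ()
sgn-injective {true}  {false} ()
sgn-injective {true}  {true}  _ = refl

±1⇒nonZero : ∀ {c} → c ≡ + 1 ⊎ c ≡ - (+ 1) → NonZero c
±1⇒nonZero (inj₁ refl) = _
±1⇒nonZero (inj₂ refl) = _

module _ {m} (Ai : F2Mat m) (b d : F2V m) (c : ℤ) where
  open ≡-Reasoning

  Tmat-on : ∀ x y → y ≡ matVec Ai x +v matVec Ai b → Tmat Ai b d c x y ≡ sgn (dot d x) * c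
  Tmat-on x y y≡ with ≡-dec _≟B_ y (matVec Ai x +v matVec Ai b)
  ... | yes _  = refl
  ... | no y≢ = ⊥-elim (y≢ y≡)

  Tmat-off : ∀ x y → y ≢ matVec Ai x +v matVec Ai b → Tmat Ai b d c x y ≡ + 0
  Tmat-off x y y≢ with ≡-dec _≟B_ y (matVec Ai x +v matVec Ai b)
  ... | yes y≡ = ⊥-elim (y≢ y≡)
  ... | no _   = refl

  TS-entry : ∀ x z →
    prodEntry m (Tmat Ai b d c) Syl x z ≡ sgn (dot d x xor dot (matVec Ai x +v matVec Ai b) z) * c
  TS-entry x z = begin
    sumVecs m (λ y → Tmat Ai b d c x y * Syl y z)  ≡⟨ sumVecs-delta m _ w off ⟩
    Tmat Ai b d c x w * Syl w z                    ≡⟨ cong (_* Syl w z) (Tmat-on x w refl) ⟩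
    sgn (dot d x) * c * sgn (dot w z)              ≡⟨ xy∙z≈xz∙y (sgn (dot d x)) c (sgn (dot w z)) ⟩
    sgn (dot d x) * sgn (dot w z) * c              ≡⟨ cong (_* c) (sym (sgn-xor (dot d x) (dot w z))) ⟩
    sgn (dot d x xor dot w z) * c                  ∎
    where
    w : F2V m
    w = matVec Ai x +v matVec Ai b
    off : ∀ y → y ≢ w → Tmat Ai b d c x y * Syl y z ≡ + 0
    off y y≢w = cong (_* Syl y z) (Tmat-off x y y≢w)

PhaseCondition : ∀ {m} → (A Ai : F2Mat m) (b d : F2V m) → Set
PhaseCondition A Ai b d = ∀ x z →
  dot d x xor dot (matVec Ai x +v matVec Ai b) z ≡ dot x (matVec A z +v b) xor dot d (matVec A z +v b)

module _ {m} (A Ai : F2Mat m) (AAi : matMul A Ai ≡ idMat m) (AiA : matMul Ai A ≡ idMat m)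
         (b d : F2V m) (c : ℤ) where
  open ≡-Reasoning

  ST-entry : ∀ x z →
    prodEntry m Syl (Tmat Ai b d c) x z ≡ sgn (dot x (matVec A z +v b) xor dot d (matVec A z +v b)) * c
  ST-entry x z = begin
    sumVecs m (λ y → Syl x y * Tmat Ai b d c y z)  ≡⟨ sumVecs-delta m _ u off ⟩
    Syl x u * Tmat Ai b d c u z                    ≡⟨ cong (Syl x u *_) (Tmat-on Ai b d c u z (sym (affine-leftInverse A Ai b AiA z))) ⟩
    sgn (dot x u) * (sgn (dot d u) * c)            ≡⟨ sym (*-assoc (sgn (dot x u)) (sgn (dot d u)) c) ⟩
    sgn (dot x u) * sgn (dot d u) * c              ≡⟨ cong (_* c) (sym (sgn-xor (dot x u) (dot d u))) ⟩
    sgn (dot x u xor dot d u) * c                  ∎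
    where
    u : F2V m
    u = matVec A z +v b
    off : ∀ y → y ≢ u → Syl x y * Tmat Ai b d c y z ≡ + 0
    off y y≢u = begin
      Syl x y * Tmat Ai b d c y z  ≡⟨ cong (Syl x y *_) (Tmat-off Ai b d c y z λ { refl → y≢u (sym (affine-rightInverse A Ai b AAi y)) }) ⟩
      Syl x y * + 0                ≡⟨ *-zeroʳ (Syl x y) ⟩
      + 0                          ∎

  commute⇔phaseCondition : .{{NonZero c}} → Commute m (Tmat Ai b d c) Syl ⇔ PhaseCondition A Ai b d
  commute⇔phaseCondition = mk⇔
    (λ comm x z → sgn-injective (*-cancelʳ-≡ _ _ c (trans (sym (TS-entry Ai b d c x z)) (trans (comm x z) (ST-entry x z)))))
    (λ phase x z → trans (TS-entry Ai b d c x z) (trans (cong (λ p → sgn p * c) (phase x z)) (sym (ST-entry x z))))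

module _ {m} (A Ai : F2Mat m) (b d : F2V m) where
  open ≡-Reasoning

  private
    expandˡ : ∀ x z → dot d x xor dot (matVec Ai x +v matVec Ai b) z
                    ≡ dot d x xor (dot (matVec Ai x) z xor dot (matVec Ai b) z)
    expandˡ x z = cong (dot d x xor_) (dot-distribʳ-+v (matVec Ai x) (matVec Ai b) z)

    expandʳ : ∀ x z → dot x (matVec A z +v b) xor dot d (matVec A z +v b)
                    ≡ (dot x (matVec A z) xor dot x b) xor (dot d (matVec A z) xor dot d b)
    expandʳ x z = cong₂ _xor_ (dot-distribˡ-+v x (matVec A z) b) (dot-distribˡ-+v d (matVec A z) b)

    regroup : ∀ p s u → p xor (s xor u) ≡ (s xor p) xor u
    regroup = solve-∀ 𝔽₂

    xor-cancel-outer : ∀ p q r s → p xor (q xor r) ≡ (s xor p) xor r → q ≡ s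
    xor-cancel-outer p q r s e = xor-cancelʳ r (xor-cancelˡ p (trans e (sym (regroup p s r))))

  phaseCondition⇒ : PhaseCondition A Ai b d → transpose A ≡ Ai × b ≡ d × dot b b ≡ false
  phaseCondition⇒ phase = transpose-A , sym d≡b , subst (λ v → dot v b ≡ false) d≡b d·b≡0
    where
    at-z₀ : ∀ x → dot d x ≡ dot x b xor dot d b
    at-z₀ x = begin
      dot d x                                                       ≡⟨ sym (xor-identityʳ _) ⟩
      dot d x xor false                                             ≡⟨ cong (dot d x xor_) (sym (dot-zeroʳ (matVec Ai x +v matVec Ai b))) ⟩
      dot d x xor dot (matVec Ai x +v matVec Ai b) (zeros m)        ≡⟨ phase x (zeros m) ⟩
      dot x (matVec A (zeros m) +v b) xor dot d (matVec A (zeros m) +v b)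
        ≡⟨ cong (λ v → dot x (v +v b) xor dot d (v +v b)) (mulVec-zeros A) ⟩
      dot x (zeros m +v b) xor dot d (zeros m +v b)                 ≡⟨ cong (λ v → dot x v xor dot d v) (+v-identityˡ b) ⟩
      dot x b xor dot d b                                           ∎
    d·b≡0 : dot d b ≡ false
    d·b≡0 = trans (sym (cong (_xor dot d b) (dot-zeroˡ b))) (trans (sym (at-z₀ (zeros m))) (dot-zeroʳ d))
    d·x≡x·b : ∀ x → dot d x ≡ dot x b
    d·x≡x·b x = trans (at-z₀ x) (trans (cong (dot x b xor_) d·b≡0) (xor-identityʳ _))
    d≡b : d ≡ b
    d≡b = dot-extensional d b (λ x → trans (d·x≡x·b x) (dot-comm x b))
    at-x₀ : ∀ z → dot (matVec Ai b) z ≡ dot d (matVec A z)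
    at-x₀ z = begin
      dot (matVec Ai b) z                                           ≡⟨ cong (λ v → dot v z) (sym (+v-identityˡ _)) ⟩
      dot (zeros m +v matVec Ai b) z                                ≡⟨ cong (λ v → dot (v +v matVec Ai b) z) (sym (mulVec-zeros Ai)) ⟩
      dot (matVec Ai (zeros m) +v matVec Ai b) z                    ≡⟨ cong (_xor dot (matVec Ai (zeros m) +v matVec Ai b) z) (sym (dot-zeroʳ d)) ⟩
      dot d (zeros m) xor dot (matVec Ai (zeros m) +v matVec Ai b) z ≡⟨ phase (zeros m) z ⟩
      dot (zeros m) (matVec A z +v b) xor dot d (matVec A z +v b)   ≡⟨ cong (_xor dot d (matVec A z +v b)) (dot-zeroˡ (matVec A z +v b)) ⟩
      dot d (matVec A z +v b)                                       ≡⟨ dot-distribˡ-+v d _ b ⟩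
      dot d (matVec A z) xor dot d b                                ≡⟨ cong (dot d (matVec A z) xor_) d·b≡0 ⟩
      dot d (matVec A z) xor false                                  ≡⟨ xor-identityʳ _ ⟩
      dot d (matVec A z)                                            ∎
    adjoint : ∀ x z → dot (matVec Ai x) z ≡ dot x (matVec A z)
    adjoint x z = xor-cancel-outer (dot x b) (dot (matVec Ai x) z) (dot d (matVec A z)) (dot x (matVec A z)) (begin
      dot x b xor (dot (matVec Ai x) z xor dot d (matVec A z))
        ≡⟨ cong₂ (λ p r → p xor (dot (matVec Ai x) z xor r)) (sym (d·x≡x·b x)) (sym (at-x₀ z)) ⟩
      dot d x xor (dot (matVec Ai x) z xor dot (matVec Ai b) z)
        ≡⟨ trans (sym (expandˡ x z)) (trans (phase x z) (expandʳ x z)) ⟩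
      (dot x (matVec A z) xor dot x b) xor (dot d (matVec A z) xor dot d b)
        ≡⟨ cong ((dot x (matVec A z) xor dot x b) xor_) (trans (cong (dot d (matVec A z) xor_) d·b≡0) (xor-identityʳ _)) ⟩
      (dot x (matVec A z) xor dot x b) xor dot d (matVec A z) ∎)
    transpose-A : transpose A ≡ Ai
    transpose-A = mulVec-extensional (transpose A) Ai (λ x → dot-extensional _ _ (λ z →
      trans (dot-mulVec-transpose A x z) (sym (adjoint x z))))

  phaseCondition⇐ : transpose A ≡ Ai → b ≡ d → dot b b ≡ false → PhaseCondition A Ai b d
  phaseCondition⇐ refl refl b·b≡0 x z = begin
    dot b x xor dot (matVec Ai x +v matVec Ai b) z                    ≡⟨ expandˡ x z ⟩
    dot b x xor (dot (matVec Ai x) z xor dot (matVec Ai b) z)         ≡⟨ cong₂ (λ p q → dot b x xor (p xor q)) (dot-mulVec-transpose A x z) (dot-mulVec-transpose A b z) ⟩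
    dot b x xor (dot x (matVec A z) xor dot b (matVec A z))           ≡⟨ regroup (dot b x) (dot x (matVec A z)) (dot b (matVec A z)) ⟩
    (dot x (matVec A z) xor dot b x) xor dot b (matVec A z)
      ≡⟨ cong₂ (λ p q → (dot x (matVec A z) xor p) xor q) (dot-comm b x) (sym (xor-identityʳ _)) ⟩
    (dot x (matVec A z) xor dot x b) xor (dot b (matVec A z) xor false)
      ≡⟨ cong (λ q → (dot x (matVec A z) xor dot x b) xor (dot b (matVec A z) xor q)) (sym b·b≡0) ⟩
    (dot x (matVec A z) xor dot x b) xor (dot b (matVec A z) xor dot b b) ≡⟨ sym (expandʳ x z) ⟩
    dot x (matVec A z +v b) xor dot b (matVec A z +v b)               ∎

  phaseCondition⇔ : PhaseCondition A Ai b d ⇔ (transpose A ≡ Ai × b ≡ d × dot b b ≡ false)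
  phaseCondition⇔ = mk⇔ phaseCondition⇒ (λ (Aᵗ≡Ai , b≡d , b·b≡0) → phaseCondition⇐ Aᵗ≡Ai b≡d b·b≡0)

dot-self≡false⇔2∣weight : ∀ {n} (x : F2V n) → dot x x ≡ false ⇔ 2 ∣ weight x
dot-self≡false⇔2∣weight x = mk⇔
  (λ x·x≡0 → even⇒2∣ (weight x) (trans (sym (dot-self x)) x·x≡0))
  (λ 2∣w → trans (dot-self x) (2∣⇒even (weight x) 2∣w))

mainTheorem3 : (m : ℕ) → 1 ≤ m →
    (A Ainv : F2Mat m) → matMul A Ainv ≡ idMat m → matMul Ainv A ≡ idMat m →
    (b d : F2V m) → (c : ℤ) → (c ≡ + 1 ⊎ c ≡ - (+ 1)) →
    Commute m (Tmat Ainv b d c) Syl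
      ⇔ (transpose A ≡ Ainv × b ≡ d × 2 ∣ weight b)
mainTheorem3 m _ A Ainv AAinv AinvA b d c c≡±1 =
  (⇔-id _ ×-⇔ ⇔-id _ ×-⇔ dot-self≡false⇔2∣weight b)
    ⇔-∘ (phaseCondition⇔ A Ainv b d
    ⇔-∘ commute⇔phaseCondition A Ainv AAinv AinvA b d c {{±1⇒nonZero c≡±1}})
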